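{- Let $k\in\{3,4,5\}$ and $d\in\{1,2,\ldots,20\}$. The pairs of integers $(n,m)$ with $n\ge k$ and $m\ge k$ satisfying $$\binom{n}{k}=\binom{m}{k}+d$$ are exactly the following (listed as $(k,d)$: solutions $(n,m)$): $(3,3)$: $(4,3)$; $(3,6)$: $(5,4)$; $(3,9)$: $(5,3)$; $(3,10)$: $(6,5)$; $(3,15)$: $(7,6)$; $(3,16)$: $(6,4)$; $(3,19)$: $(6,3)$; $(4,4)$: $(5,4)$; $(4,10)$: $(6,5)$; $(4,14)$: $(6,4)$; $(4,20)$: $(7,6)$; $(5,5)$: $(6,5)$; $(5,15)$: $(7,6)$; $(5,20)$: $(7,5)$. For every other pair $(k,d)$ with $k\in\{3,4,5\}$, $d\in\{1,\ldots,20\}$, there is no such solution.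
   Context: For an integer $x$ and a positive integer $k$, $\binom{x}{k}=\frac{x(x-1)\cdots(x-k+1)}{k!}$. -}

module Defs where

open import Data.Nat using (ℕ)
open import Data.Product using (_×_; _,_)
open import Data.List using (List; _∷_; [])

-- The exceptional solutions, as quadruples (k , d , n , m).
solutionList : List (ℕ × ℕ × ℕ × ℕ)
solutionList =
  (3 , 3 , 4 , 3) ∷ (3 , 6 , 5 , 4) ∷ (3 , 9 , 5 , 3) ∷ (3 , 10 , 6 , 5) ∷
  (3 , 15 , 7 , 6) ∷ (3 , 16 , 6 , 4) ∷ (3 , 19 , 6 , 3) ∷
  (4 , 4 , 5 , 4) ∷ (4 , 10 , 6 , 5) ∷ (4 , 14 , 6 , 4) ∷ (4 , 20 , 7 , 6) ∷
  (5 , 5 , 6 , 5) ∷ (5 , 15 , 7 , 6) ∷ (5 , 20 , 7 , 5) ∷ []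

{-# OPTIONS --safe #-}
-- If n C k = m C k + d with d > 0 then m < n, so by Pascal's rule
-- d ≥ n C k − (n−1) C k = (n−1) C (k−1). For k ∈ {3,4,5} already 7 C (k−1) > 20 ≥ d,
-- hence n ≤ 7, and the finitely many remaining (d, n, m) are decided by computation.
module Submission where

open import Defs
open import Data.Nat using (ℕ; zero; suc; _+_; _≤_; _≥_; _<_; s≤s)
open import Data.Nat.Properties
open import Data.Nat.Combinatorics using (_C_; nCk+nC[k+1]≡[n+1]C[k+1])
open import Data.Product using (_×_; _,_)
open import Data.Product.Properties using (≡-dec)
open import Data.Sum using (_⊎_; inj₁; inj₂)
open import Data.List.Membership.Propositional using (_∈_)
open import Data.List.Membership.DecPropositional (≡-dec _≟_ (≡-dec _≟_ (≡-dec _≟_ _≟_))) using (_∈?_)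
open import Data.List.Relation.Unary.All using (All; _∷_; []; lookup)
open import Relation.Binary.PropositionalEquality using (_≡_; refl)
open import Relation.Nullary using (Dec; _→-dec_)
open import Relation.Nullary.Decidable using (toWitness)
open import Data.Unit using (tt)
open import Function.Bundles using (_⇔_; mk⇔)

nCk≤[1+n]Ck : ∀ n k → n C k ≤ suc n C k
nCk≤[1+n]Ck n zero    = ≤-refl
nCk≤[1+n]Ck n (suc k) =
  ≤-trans (m≤n+m (n C suc k) (n C k)) (≤-reflexive (nCk+nC[k+1]≡[n+1]C[k+1] n k))

C-monoˡ-≤ : ∀ {m n} k → m ≤ n → m C k ≤ n C k
C-monoˡ-≤ k m≤n with m≤n⇒m<n∨m≡n m≤n
... | inj₂ refl          = ≤-refl
... | inj₁ (s≤s m≤pred-n) = ≤-trans (C-monoˡ-≤ k m≤pred-n) (nCk≤[1+n]Ck _ k)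

C-gap : ∀ {m n} k → m ≤ n → m C suc k + n C k ≤ suc n C suc k
C-gap {m} {n} k m≤n = begin
  m C suc k + n C k ≤⟨ +-monoˡ-≤ (n C k) (C-monoˡ-≤ (suc k) m≤n) ⟩
  n C suc k + n C k ≡⟨ +-comm (n C suc k) (n C k) ⟩
  n C k + n C suc k ≡⟨ nCk+nC[k+1]≡[n+1]C[k+1] n k ⟩
  suc n C suc k     ∎
  where open ≤-Reasoning

C-equation⇒< : ∀ {k d n m} → 0 < d → n C k ≡ m C k + d → m < n
C-equation⇒< {k} {d} {n} {m} 0<d eq = ≰⇒> λ n≤m → <-irrefl eq (begin-strict
  n C k     ≤⟨ C-monoˡ-≤ k n≤m ⟩
  m C k     <⟨ m<m+n (m C k) 0<d ⟩
  m C k + d ∎)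
  where open ≤-Reasoning

solution-bound : ∀ {N k d n m} → d < N C k → 0 < d →
                 n C suc k ≡ m C suc k + d → m < n × n ≤ N
solution-bound {N} {k} {d} {n} {m} d<NCk 0<d eq with C-equation⇒< {suc k} {d} {n} {m} 0<d eq
solution-bound {N} {k} {d} {suc n} {m} d<NCk 0<d eq | m<1+n@(s≤s m≤n) =
  m<1+n , ≰⇒> λ N≤n → <⇒≱ d<NCk (≤-trans (C-monoˡ-≤ k N≤n) nCk≤d)
  where
  nCk≤d : n C k ≤ d
  nCk≤d = +-cancelˡ-≤ (m C suc k) (n C k) d (begin
    m C suc k + n C k ≤⟨ C-gap k m≤n ⟩
    suc n C suc k     ≡⟨ eq ⟩
    m C suc k + d     ∎)
    where open ≤-Reasoning

SolutionListed : ℕ → ℕ → ℕ → ℕ → Set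
SolutionListed k d n m = 0 < d → k ≤ m → n C k ≡ m C k + d → (k , d , n , m) ∈ solutionList

solutionListed? : ∀ k d n m → Dec (SolutionListed k d n m)
solutionListed? k d n m =
  0 <? d →-dec k ≤? m →-dec (n C k ≟ m C k + d) →-dec ((k , d , n , m) ∈? solutionList)

ListedBelow : ℕ → Set
ListedBelow k = ∀ {d} → d < 21 → ∀ {n} → n < 8 → ∀ {m} → m < 8 → SolutionListed k d n m

listedBelow? : ∀ k → Dec (ListedBelow k)
listedBelow? k =
  allUpTo? (λ d → allUpTo? (λ n → allUpTo? (solutionListed? k d n) 8) 8) 21

listed-by-bound : ∀ {k d n m} → ListedBelow (suc k) → 20 < 7 C k → 0 < d → d ≤ 20 →
                  suc k ≤ m → n C suc k ≡ m C suc k + d → (suc k , d , n , m) ∈ solutionList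
listed-by-bound {k} {d} {n} {m} listed 20<7Ck 0<d d≤20 k<m eq
  with solution-bound {7} {k} {d} {n} {m} (<-≤-trans (s≤s d≤20) 20<7Ck) 0<d eq
... | m<n , n≤7 = listed (s≤s d≤20) (s≤s n≤7) (≤-trans m<n (m≤n⇒m≤1+n n≤7)) 0<d k<m eq

solutions-listed : ∀ {k d n m} → (k ≡ 3 ⊎ k ≡ 4 ⊎ k ≡ 5) → 0 < d → d ≤ 20 →
                   k ≤ m → n C k ≡ m C k + d → (k , d , n , m) ∈ solutionList
solutions-listed (inj₁ refl) =
  listed-by-bound (toWitness {a? = listedBelow? 3} tt) (toWitness {a? = 20 <? 7 C 2} tt)
solutions-listed (inj₂ (inj₁ refl)) =
  listed-by-bound (toWitness {a? = listedBelow? 4} tt) (toWitness {a? = 20 <? 7 C 3} tt)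
solutions-listed (inj₂ (inj₂ refl)) =
  listed-by-bound (toWitness {a? = listedBelow? 5} tt) (toWitness {a? = 20 <? 7 C 4} tt)

listed-are-solutions : All (λ { (k , d , n , m) → n C k ≡ m C k + d }) solutionList
listed-are-solutions =
  refl ∷ refl ∷ refl ∷ refl ∷ refl ∷ refl ∷ refl ∷ refl ∷ refl ∷ refl ∷ refl ∷ refl ∷ refl ∷ refl ∷ []

theorem2 : (k d n m : ℕ) → (k ≡ 3 ⊎ k ≡ 4 ⊎ k ≡ 5) → 1 ≤ d → d ≤ 20 → n ≥ k → m ≥ k →
    ((n C k ≡ m C k + d) ⇔ ((k , d , n , m) ∈ solutionList))
theorem2 k d n m k∈345 0<d d≤20 _ k≤m =
  mk⇔ (solutions-listed k∈345 0<d d≤20 k≤m) (lookup listed-are-solutions)
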